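{- Let $r,s,k$ be positive integers with $r+s$ dividing $k$, and let $q\ge 0$ be an integer. Suppose $n\ge k$ and $$n\ge\max\left\{k\left\lfloor\frac{q-r}{r+s}+\frac{rsk}{(r+s)^2}\right\rfloor+\frac{sk}{r+s}+\frac{r}{s},\; k\left\lfloor\frac{q-s}{r+s}+\frac{rsk}{(r+s)^2}\right\rfloor+\frac{rk}{r+s}+\frac{s}{r}\right\}.$$ Then every function $f:[n]\to\{ -r,s\}$ with $|f([n])|\le q$ has a $k$-block $B\subseteq[n]$ with $f(B)=0$.
   Context: $[n]=\{1,\ldots,n\}$; for $Y\subseteq[n]$, $f(Y)=\sum_{y\in Y}f(y)$. A $k$-block is a set of $k$ consecutive integers. -}

module Defs where

open import Data.Nat as ℕ using (ℕ; zero; suc)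
open import Data.Integer as ℤ using (ℤ; +_)
open import Data.Rational as ℚ using (ℚ)

-- a / d as a rational, for d : ℕ.  The value for d = 0 is a junk value 0;
-- it is only ever used with d > 0 (guaranteed by the hypotheses).
frac : ℤ → ℕ → ℚ
frac a zero    = ℚ.0ℚ
frac a (suc d) = a ℚ./ suc d

-- f(B) for the k-block B = {a+1, …, a+k}:  Σ_{i=a+1}^{a+k} f i
blockSum : (ℕ → ℤ) → ℕ → ℕ → ℤ
blockSum f a zero    = + 0
blockSum f a (suc k) = blockSum f a k ℤ.+ f (a ℕ.+ suc k)

total : (ℕ → ℤ) → ℕ → ℤ
total f n = blockSum f 0 n

bound₁ : ℕ → ℕ → ℕ → ℕ → ℚ
bound₁ r s k q =
  frac (+ k ℤ.* ℚ.floor (frac (+ q ℤ.- + r) (r ℕ.+ s) ℚ.+ frac (+ (r ℕ.* s ℕ.* k)) ((r ℕ.+ s) ℕ.^ 2)))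
       1
  ℚ.+ frac (+ (s ℕ.* k)) (r ℕ.+ s) ℚ.+ frac (+ r) s

bound₂ : ℕ → ℕ → ℕ → ℕ → ℚ
bound₂ r s k q =
  frac (+ k ℤ.* ℚ.floor (frac (+ q ℤ.- + s) (r ℕ.+ s) ℚ.+ frac (+ (r ℕ.* s ℕ.* k)) ((r ℕ.+ s) ℕ.^ 2)))
       1
  ℚ.+ frac (+ (r ℕ.* k)) (r ℕ.+ s) ℚ.+ frac (+ s) r

-- Let d = r + s, k = m d, and call an entry heavy if it equals s.  A k-block with c heavy
-- entries has sum d c − r k = d (c − r m), and sliding the block by one position changes c by
-- at most one; so either some block has c = r m, or all blocks have c > r m, or all have
-- c < r m.  Replacing f by −f swaps r with s and bound₁ with bound₂, so it suffices to show that
-- if every block sum is positive then f([n]) > q.  Write n = e + t k with e < k, and let c be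
-- the number of heavy entries among the first e positions.  The t disjoint blocks after them
-- give f([n]) ≥ d (c + t) − r e, and the first block gives e < c + s m.  With L the floor in
-- bound₁, the hypothesis n ≥ bound₁ rules out t < L, and for t > L and t = L the two estimates
-- combine into q + r e < d (c + t).

module Submission where

open import Defs
open import Data.Nat as ℕ using (ℕ; zero; suc; _≤_; _<_; z≤n; s≤s; NonZero)
import Data.Nat.Properties as ℕP
open import Data.Nat.DivMod using (_/_; _%_; m≡m%n+[m/n]*n; m%n<n)
open import Data.Nat.Divisibility using (_∣_; divides)
import Data.Nat.Tactic.RingSolver as ℕ-Solver
open import Data.Integer as ℤ using (ℤ; +_; -_; 0ℤ; ∣_∣)
import Data.Integer.Properties as ℤP
open import Data.Integer.DivMod using (div-pos-is-/ℕ; n<s[n/ℕd]*d)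
open import Data.Integer.Tactic.RingSolver using (solve-∀)
open import Data.Rational as ℚ using (ℚ; ↥_; ↧_; ↧ₙ_; floor)
import Data.Rational.Properties as ℚP
open import Data.Rational.Unnormalised as ℚᵘ using (mkℚᵘ; *≡*)
import Data.Rational.Unnormalised.Properties as ℚᵘP
open import Data.Product using (Σ; _×_; _,_)
open import Data.Sum using (_⊎_; inj₁; inj₂)
open import Data.Empty using (⊥-elim)
open import Relation.Nullary using (yes; no)
open import Relation.Binary.Definitions using (tri<; tri≈; tri>)
open import Relation.Binary.PropositionalEquality

toℚᵘ-frac : ∀ a d .{{_ : NonZero d}} → ℚ.toℚᵘ (frac a d) ℚᵘ.≃ a ℚᵘ./ d
toℚᵘ-frac a (suc d) = ℚP.toℚᵘ-fromℚᵘ (mkℚᵘ a d)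

↥<s[floor]*↧ : ∀ x → ↥ x ℤ.< ℤ.suc (floor x) ℤ.* ↧ x
↥<s[floor]*↧ x@record{} =
  subst (λ F → ↥ x ℤ.< ℤ.suc F ℤ.* ↧ x) (sym (div-pos-is-/ℕ (↥ x) (↧ₙ x))) (n<s[n/ℕd]*d (↥ x) (↧ₙ x))

↥ᵘ<s[floor]*↧ᵘ : ∀ x y → ℚ.toℚᵘ x ℚᵘ.≃ y → ℚᵘ.↥ y ℤ.< ℤ.suc (floor x) ℤ.* ℚᵘ.↧ y
↥ᵘ<s[floor]*↧ᵘ x@record{} y (*≡* eq) = ℤP.*-cancelʳ-<-nonNeg (↧ x) (begin-strict
  ℚᵘ.↥ y ℤ.* ↧ x                  ≡⟨ sym eq ⟩
  ↥ x ℤ.* ℚᵘ.↧ y                  <⟨ ℤP.*-monoʳ-<-pos (ℚᵘ.↧ y) (↥<s[floor]*↧ x) ⟩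
  ℤ.suc F ℤ.* ↧ x ℤ.* ℚᵘ.↧ y      ≡⟨ swap (ℤ.suc F) (↧ x) (ℚᵘ.↧ y) ⟩
  ℤ.suc F ℤ.* ℚᵘ.↧ y ℤ.* ↧ x      ∎)
  where
  open ℤP.≤-Reasoning
  F = floor x
  swap : ∀ a b c → a ℤ.* b ℤ.* c ≡ a ℤ.* c ℤ.* b
  swap = solve-∀

boundFloor : ℕ → ℕ → ℕ → ℕ → ℤ
boundFloor r s k q =
  floor (frac (+ q ℤ.- + r) (r ℕ.+ s) ℚ.+ frac (+ (r ℕ.* s ℕ.* k)) ((r ℕ.+ s) ℕ.^ 2))

pos-^2 : ∀ n → + (n ℕ.^ 2) ≡ + n ℤ.* + n
pos-^2 n = trans (cong +_ (cong (n ℕ.*_) (ℕP.*-identityʳ n))) (ℤP.pos-* n n)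

q+rsm<s[boundFloor]*d+r : ∀ r s m q .{{_ : NonZero r}} →
  + q ℤ.+ + r ℤ.* + s ℤ.* + m ℤ.< ℤ.suc (boundFloor r s (m ℕ.* (r ℕ.+ s)) q) ℤ.* (+ r ℤ.+ + s) ℤ.+ + r
q+rsm<s[boundFloor]*d+r r@(suc _) s m q = begin-strict
  + q ℤ.+ R ℤ.* S ℤ.* M                 ≡⟨ shift (+ q) R (R ℤ.* S ℤ.* M) ⟩
  (+ q ℤ.- R ℤ.+ R ℤ.* S ℤ.* M) ℤ.+ R    <⟨ ℤP.+-monoˡ-< R (ℤP.*-cancelˡ-<-nonNeg (+ (d ℕ.* d)) scaled) ⟩
  ℤ.suc L ℤ.* D ℤ.+ R                   ≡⟨ cong (λ e → ℤ.suc L ℤ.* e ℤ.+ R) (ℤP.pos-+ r s) ⟩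
  ℤ.suc L ℤ.* (R ℤ.+ S) ℤ.+ R           ∎
  where
  open ℤP.≤-Reasoning
  d = r ℕ.+ s
  R = + r
  S = + s
  M = + m
  D = + d
  L = boundFloor r s (m ℕ.* d) q
  x = frac (+ q ℤ.- R) d ℚ.+ frac (+ (r ℕ.* s ℕ.* (m ℕ.* d))) (d ℕ.^ 2)
  y = (+ q ℤ.- R) ℚᵘ./ d ℚᵘ.+ + (r ℕ.* s ℕ.* (m ℕ.* d)) ℚᵘ./ (d ℕ.^ 2)
  x≃y : ℚ.toℚᵘ x ℚᵘ.≃ y
  x≃y = ℚᵘP.≃-trans (ℚP.toℚᵘ-homo-+ (frac (+ q ℤ.- R) d) (frac (+ (r ℕ.* s ℕ.* (m ℕ.* d))) (d ℕ.^ 2)))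
          (ℚᵘP.+-cong (toℚᵘ-frac (+ q ℤ.- R) d) (toℚᵘ-frac (+ (r ℕ.* s ℕ.* (m ℕ.* d))) (d ℕ.^ 2)))
  below : (+ q ℤ.- R) ℤ.* + (d ℕ.^ 2) ℤ.+ + (r ℕ.* s ℕ.* (m ℕ.* d)) ℤ.* D ℤ.< ℤ.suc L ℤ.* + (d ℕ.* d ℕ.^ 2)
  below = ↥ᵘ<s[floor]*↧ᵘ x y x≃y
  expandˡ : ∀ Q R S M D → (Q ℤ.- R) ℤ.* (D ℤ.* D) ℤ.+ R ℤ.* S ℤ.* (M ℤ.* D) ℤ.* D
                        ≡ (D ℤ.* D) ℤ.* (Q ℤ.- R ℤ.+ R ℤ.* S ℤ.* M)
  expandˡ = solve-∀
  expandʳ : ∀ D L → L ℤ.* (D ℤ.* (D ℤ.* D)) ≡ (D ℤ.* D) ℤ.* (L ℤ.* D)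
  expandʳ = solve-∀
  scaled : + (d ℕ.* d) ℤ.* (+ q ℤ.- R ℤ.+ R ℤ.* S ℤ.* M) ℤ.< + (d ℕ.* d) ℤ.* (ℤ.suc L ℤ.* D)
  scaled = subst (λ e → e ℤ.* (+ q ℤ.- R ℤ.+ R ℤ.* S ℤ.* M) ℤ.< e ℤ.* (ℤ.suc L ℤ.* D)) (sym (ℤP.pos-* d d))
    (subst₂ ℤ._<_
      (trans (cong₂ (λ u v → (+ q ℤ.- R) ℤ.* u ℤ.+ v ℤ.* D) (pos-^2 d)
                    (trans (ℤP.pos-* (r ℕ.* s) (m ℕ.* d)) (cong₂ ℤ._*_ (ℤP.pos-* r s) (ℤP.pos-* m d))))
             (expandˡ (+ q) R S M D))
      (trans (cong (ℤ.suc L ℤ.*_) (trans (ℤP.pos-* d (d ℕ.^ 2)) (cong (D ℤ.*_) (pos-^2 d))))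
             (expandʳ D (ℤ.suc L)))
      below)
  shift : ∀ Q R X → Q ℤ.+ X ≡ (Q ℤ.- R ℤ.+ X) ℤ.+ R
  shift = solve-∀

bound₁-cleared : ∀ r s m q n .{{_ : NonZero r}} .{{_ : NonZero s}} →
  bound₁ r s (m ℕ.* (r ℕ.+ s)) q ℚ.≤ frac (+ n) 1 →
  + m ℤ.* (+ r ℤ.+ + s) ℤ.* boundFloor r s (m ℕ.* (r ℕ.+ s)) q ℤ.* + s ℤ.+ + s ℤ.* + s ℤ.* + m ℤ.+ + r ℤ.≤ + n ℤ.* + s
bound₁-cleared r@(suc _) s@(suc _) m q n h =
  subst (λ e → + m ℤ.* e ℤ.* L ℤ.* S ℤ.+ S ℤ.* S ℤ.* M ℤ.+ R ℤ.≤ + n ℤ.* S) (ℤP.pos-+ r s)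
    (ℤP.*-cancelˡ-≤-pos _ _ D (subst₂ ℤ._≤_ expandˡ expandʳ cross))
  where
  d = r ℕ.+ s
  k = m ℕ.* d
  R = + r
  S = + s
  M = + m
  D = + d
  L = boundFloor r s k q
  lhs≃ : ℚ.toℚᵘ (bound₁ r s k q) ℚᵘ.≃ ((+ k ℤ.* L) ℚᵘ./ 1 ℚᵘ.+ + (s ℕ.* k) ℚᵘ./ d) ℚᵘ.+ R ℚᵘ./ s
  lhs≃ = ℚᵘP.≃-trans (ℚP.toℚᵘ-homo-+ (frac (+ k ℤ.* L) 1 ℚ.+ frac (+ (s ℕ.* k)) d) (frac R s))
           (ℚᵘP.+-cong (ℚᵘP.≃-trans (ℚP.toℚᵘ-homo-+ (frac (+ k ℤ.* L) 1) (frac (+ (s ℕ.* k)) d))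
                          (ℚᵘP.+-cong (toℚᵘ-frac (+ k ℤ.* L) 1) (toℚᵘ-frac (+ (s ℕ.* k)) d)))
                       (toℚᵘ-frac R s))
  cross : ((+ k ℤ.* L ℤ.* D ℤ.+ + (s ℕ.* k) ℤ.* + 1) ℤ.* S ℤ.+ R ℤ.* + (1 ℕ.* d)) ℤ.* + 1
          ℤ.≤ + n ℤ.* + (1 ℕ.* d ℕ.* s)
  cross = ℚᵘP.drop-*≤* (ℚᵘP.≤-respʳ-≃ (toℚᵘ-frac (+ n) 1) (ℚᵘP.≤-respˡ-≃ lhs≃ (ℚP.toℚᵘ-mono-≤ h)))
  pos-k : + k ≡ M ℤ.* D
  pos-k = ℤP.pos-* m d
  pos-d : + (1 ℕ.* d) ≡ D
  pos-d = cong +_ (ℕP.*-identityˡ d)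
  expandˡ : ((+ k ℤ.* L ℤ.* D ℤ.+ + (s ℕ.* k) ℤ.* + 1) ℤ.* S ℤ.+ R ℤ.* + (1 ℕ.* d)) ℤ.* + 1
          ≡ D ℤ.* (M ℤ.* D ℤ.* L ℤ.* S ℤ.+ S ℤ.* S ℤ.* M ℤ.+ R)
  expandˡ = begin
    ((+ k ℤ.* L ℤ.* D ℤ.+ + (s ℕ.* k) ℤ.* + 1) ℤ.* S ℤ.+ R ℤ.* + (1 ℕ.* d)) ℤ.* + 1
      ≡⟨ cong (λ w → ((+ k ℤ.* L ℤ.* D ℤ.+ + (s ℕ.* k) ℤ.* + 1) ℤ.* S ℤ.+ R ℤ.* w) ℤ.* + 1) pos-d ⟩
    ((+ k ℤ.* L ℤ.* D ℤ.+ + (s ℕ.* k) ℤ.* + 1) ℤ.* S ℤ.+ R ℤ.* D) ℤ.* + 1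
      ≡⟨ cong₂ (λ u v → ((u ℤ.* L ℤ.* D ℤ.+ v ℤ.* + 1) ℤ.* S ℤ.+ R ℤ.* D) ℤ.* + 1) pos-k
               (trans (ℤP.pos-* s k) (cong (S ℤ.*_) pos-k)) ⟩
    ((M ℤ.* D ℤ.* L ℤ.* D ℤ.+ S ℤ.* (M ℤ.* D) ℤ.* + 1) ℤ.* S ℤ.+ R ℤ.* D) ℤ.* + 1
      ≡⟨ distribute M D L S R ⟩
    D ℤ.* (M ℤ.* D ℤ.* L ℤ.* S ℤ.+ S ℤ.* S ℤ.* M ℤ.+ R) ∎
    where
    open ≡-Reasoning
    distribute : ∀ M D L S R → ((M ℤ.* D ℤ.* L ℤ.* D ℤ.+ S ℤ.* (M ℤ.* D) ℤ.* + 1) ℤ.* S ℤ.+ R ℤ.* D) ℤ.* + 1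
                                 ≡ D ℤ.* (M ℤ.* D ℤ.* L ℤ.* S ℤ.+ S ℤ.* S ℤ.* M ℤ.+ R)
    distribute = solve-∀
  expandʳ : + n ℤ.* + (1 ℕ.* d ℕ.* s) ≡ D ℤ.* (+ n ℤ.* S)
  expandʳ = trans (cong (+ n ℤ.*_) (trans (ℤP.pos-* (1 ℕ.* d) s) (cong (ℤ._* S) pos-d))) (rearrange (+ n) D S)
    where
    rearrange : ∀ N D S → N ℤ.* (D ℤ.* S) ≡ D ℤ.* (N ℤ.* S)
    rearrange = solve-∀

bound₂≡bound₁-swapped : ∀ r s k q → bound₂ r s k q ≡ bound₁ s r k q
bound₂≡bound₁-swapped r s k q = cong₂ shape (ℕP.+-comm r s) (ℕP.*-comm r s)
  where
  shape : ℕ → ℕ → ℚ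
  shape d p = frac (+ k ℤ.* floor (frac (+ q ℤ.- + s) d ℚ.+ frac (+ (p ℕ.* k)) (d ℕ.^ 2))) 1
              ℚ.+ frac (+ (r ℕ.* k)) d ℚ.+ frac (+ s) r

0≤+ : ∀ n → 0ℤ ℤ.≤ + n
0≤+ n = ℤ.+≤+ z≤n

0≤-+ : ∀ {i j} → 0ℤ ℤ.≤ i → 0ℤ ℤ.≤ j → 0ℤ ℤ.≤ i ℤ.+ j
0≤-+ = ℤP.+-mono-≤

0≤-* : ∀ {i j} → 0ℤ ℤ.≤ i → 0ℤ ℤ.≤ j → 0ℤ ℤ.≤ i ℤ.* j
0≤-* {j = j} 0≤i 0≤j = ℤP.*-monoʳ-≤-nonNeg j {{ℤ.nonNegative 0≤j}} 0≤i

≤-gap : ∀ {i j} → i ℤ.≤ j → 0ℤ ℤ.≤ j ℤ.- i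
≤-gap = ℤP.i≤j⇒0≤j-i

<-gap : ∀ {i j} → i ℤ.< j → 0ℤ ℤ.≤ j ℤ.- (+ 1 ℤ.+ i)
<-gap i<j = ℤP.i≤j⇒0≤j-i (ℤP.i<j⇒suc[i]≤j i<j)

≤-by-gap : ∀ {i j} g → j ≡ i ℤ.+ g → 0ℤ ℤ.≤ g → i ℤ.≤ j
≤-by-gap {i} g refl 0≤g = ℤP.i≤i+j i g {{ℤ.nonNegative 0≤g}}

<-by-gap : ∀ {i j} g → j ≡ + 1 ℤ.+ i ℤ.+ g → 0ℤ ℤ.≤ g → i ℤ.< j
<-by-gap g eq 0≤g = ℤP.suc[i]≤j⇒i<j (≤-by-gap g eq 0≤g)

remainder-boundℤ : ∀ r s m q t e c (L : ℤ) .{{_ : NonZero s}} →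
  let R = + r ; S = + s ; D = + r ℤ.+ + s ; K = + m ℤ.* (+ r ℤ.+ + s) in
  + e ℤ.< K → + e ℤ.< + c ℤ.+ S ℤ.* + m →
  + q ℤ.+ R ℤ.* S ℤ.* + m ℤ.< ℤ.suc L ℤ.* D ℤ.+ R →
  K ℤ.* L ℤ.* S ℤ.+ S ℤ.* S ℤ.* + m ℤ.+ R ℤ.≤ (+ t ℤ.* K ℤ.+ + e) ℤ.* S →
  + q ℤ.+ R ℤ.* + e ℤ.< D ℤ.* (+ c ℤ.+ + t)
-- In each case the slack of the conclusion is a nonnegative combination of the slacks of the
-- hypotheses (the certificate); for t < L the same combination would make 0 positive.
remainder-boundℤ r s@(suc s-1) m q t e c L e<k e<c+sm large small with ℤP.<-cmp L (+ t)
... | tri< L<t _ _ = <-by-gap _ (certificate (+ r) (+ s) (+ m) (+ q) (+ t) (+ e) (+ c) L)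
  (0≤-+ (0≤-+ (0≤-+ (0≤-* (0≤-+ (0≤+ r) (0≤+ s)) (<-gap L<t)) (0≤-* (0≤+ s) (0≤+ c)))
               (0≤-* (0≤+ r) (<-gap e<c+sm)))
         (<-gap large))
  where
  certificate : ∀ R S M Q T E C L → (R ℤ.+ S) ℤ.* (C ℤ.+ T) ≡ + 1 ℤ.+ (Q ℤ.+ R ℤ.* E) ℤ.+
    ((R ℤ.+ S) ℤ.* (T ℤ.- (+ 1 ℤ.+ L)) ℤ.+ S ℤ.* C ℤ.+ R ℤ.* (C ℤ.+ S ℤ.* M ℤ.- (+ 1 ℤ.+ E))
     ℤ.+ ((+ 1 ℤ.+ L) ℤ.* (R ℤ.+ S) ℤ.+ R ℤ.- (+ 1 ℤ.+ (Q ℤ.+ R ℤ.* S ℤ.* M))))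
  certificate = solve-∀
... | tri≈ _ refl _ = <-by-gap _ (certificate (+ r) (+ s) (+ m) (+ q) (+ t) (+ e) (+ c))
  (0≤-+ (0≤-+ (0≤-* (0≤-+ (0≤+ r) (0≤+ s)) (<-gap e<c+sm)) (≤-gap small)) (<-gap large))
  where
  certificate : ∀ R S M Q T E C → (R ℤ.+ S) ℤ.* (C ℤ.+ T) ≡ + 1 ℤ.+ (Q ℤ.+ R ℤ.* E) ℤ.+
    ((R ℤ.+ S) ℤ.* (C ℤ.+ S ℤ.* M ℤ.- (+ 1 ℤ.+ E))
     ℤ.+ ((T ℤ.* (M ℤ.* (R ℤ.+ S)) ℤ.+ E) ℤ.* S ℤ.- (M ℤ.* (R ℤ.+ S) ℤ.* T ℤ.* S ℤ.+ S ℤ.* S ℤ.* M ℤ.+ R))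
     ℤ.+ ((+ 1 ℤ.+ T) ℤ.* (R ℤ.+ S) ℤ.+ R ℤ.- (+ 1 ℤ.+ (Q ℤ.+ R ℤ.* S ℤ.* M))))
  certificate = solve-∀
... | tri> _ _ t<L = ⊥-elim (ℤP.<-irrefl refl (<-by-gap _ (certificate (+ r) (+ s-1) (+ m) (+ t) (+ e) L)
  (0≤-+ (0≤-+ (0≤-+ (0≤-+ (0≤-+ (≤-gap small)
                                (0≤-* (0≤-* (0≤-* (0≤+ m) (0≤-+ (0≤+ r) (0≤+ s))) (0≤+ s)) (<-gap t<L)))
                         (0≤-* (0≤+ s) (<-gap e<k)))
                  (0≤-* (0≤-* (0≤+ s) (0≤+ s)) (0≤+ m)))
           (0≤+ r))
    (0≤+ s-1))))
  where
  certificate : ∀ R S-1 M T E L → let S = + 1 ℤ.+ S-1 ; K = M ℤ.* (R ℤ.+ S) in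
    0ℤ ≡ + 1 ℤ.+ 0ℤ ℤ.+ ((T ℤ.* K ℤ.+ E) ℤ.* S ℤ.- (K ℤ.* L ℤ.* S ℤ.+ S ℤ.* S ℤ.* M ℤ.+ R)
      ℤ.+ K ℤ.* S ℤ.* (L ℤ.- (+ 1 ℤ.+ T)) ℤ.+ S ℤ.* (K ℤ.- (+ 1 ℤ.+ E)) ℤ.+ S ℤ.* S ℤ.* M ℤ.+ R ℤ.+ S-1)
  certificate = solve-∀

remainder-bound : ∀ r s m q t e c (L : ℤ) .{{_ : NonZero s}} →
  e < m ℕ.* (r ℕ.+ s) → e < c ℕ.+ s ℕ.* m →
  + q ℤ.+ + r ℤ.* + s ℤ.* + m ℤ.< ℤ.suc L ℤ.* (+ r ℤ.+ + s) ℤ.+ + r →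
  + m ℤ.* (+ r ℤ.+ + s) ℤ.* L ℤ.* + s ℤ.+ + s ℤ.* + s ℤ.* + m ℤ.+ + r ℤ.≤ + (e ℕ.+ t ℕ.* (m ℕ.* (r ℕ.+ s))) ℤ.* + s →
  q ℕ.+ r ℕ.* e < (r ℕ.+ s) ℕ.* (c ℕ.+ t)
remainder-bound r s m q t e c L e<k e<c+sm large small =
  ℤP.drop‿+<+ (subst₂ ℤ._<_ (cong (ℤ._+_ (+ q)) (sym (ℤP.pos-* r e))) (sym (ℤP.pos-* (r ℕ.+ s) (c ℕ.+ t)))
    (remainder-boundℤ r s m q t e c L
      (subst (+ e ℤ.<_) (ℤP.pos-* m (r ℕ.+ s)) (ℤ.+<+ e<k))
      (subst (λ x → + e ℤ.< + c ℤ.+ x) (ℤP.pos-* s m) (ℤ.+<+ e<c+sm))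
      large
      (subst (λ x → _ ℤ.≤ x ℤ.* + s) n-cast small)))
  where
  n-cast : + (e ℕ.+ t ℕ.* (m ℕ.* (r ℕ.+ s))) ≡ + t ℤ.* (+ m ℤ.* (+ r ℤ.+ + s)) ℤ.+ + e
  n-cast = trans (ℤP.+-comm (+ e) (+ (t ℕ.* (m ℕ.* (r ℕ.+ s)))))
                 (cong (ℤ._+ + e) (trans (ℤP.pos-* t _) (cong (+ t ℤ.*_) (ℤP.pos-* m (r ℕ.+ s)))))

blockCount : (ℕ → ℕ) → ℕ → ℕ → ℕ
blockCount b a zero    = 0
blockCount b a (suc k) = blockCount b a k ℕ.+ b (a ℕ.+ suc k)

blockCount-+ : ∀ b a x y → blockCount b a (x ℕ.+ y) ≡ blockCount b a x ℕ.+ blockCount b (a ℕ.+ x) y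
blockCount-+ b a x zero = trans (cong (blockCount b a) (ℕP.+-identityʳ x)) (sym (ℕP.+-identityʳ _))
blockCount-+ b a x (suc y) = begin
  blockCount b a (x ℕ.+ suc y)                                  ≡⟨ cong (blockCount b a) (ℕP.+-suc x y) ⟩
  blockCount b a (x ℕ.+ y) ℕ.+ b (a ℕ.+ suc (x ℕ.+ y))          ≡⟨ cong₂ ℕ._+_ (blockCount-+ b a x y) (cong b index) ⟩
  blockCount b a x ℕ.+ blockCount b (a ℕ.+ x) y ℕ.+ b (a ℕ.+ x ℕ.+ suc y) ≡⟨ ℕP.+-assoc (blockCount b a x) _ _ ⟩
  blockCount b a x ℕ.+ blockCount b (a ℕ.+ x) (suc y)           ∎
  where
  open ≡-Reasoning
  index : a ℕ.+ suc (x ℕ.+ y) ≡ a ℕ.+ x ℕ.+ suc y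
  index = trans (cong (a ℕ.+_) (sym (ℕP.+-suc x y))) (sym (ℕP.+-assoc a x (suc y)))

module _ (b : ℕ → ℕ) (b≤1 : ∀ i → b i ≤ 1) where

  blockCount≤length : ∀ a k → blockCount b a k ≤ k
  blockCount≤length a zero    = z≤n
  blockCount≤length a (suc k) =
    subst (blockCount b a (suc k) ≤_) (ℕP.+-comm k 1) (ℕP.+-mono-≤ (blockCount≤length a k) (b≤1 (a ℕ.+ suc k)))

  blockCount≤prefix+rest : ∀ {e k} → e ≤ k → blockCount b 0 k ≤ blockCount b 0 e ℕ.+ (k ℕ.∸ e)
  blockCount≤prefix+rest {e} {k} e≤k = begin
    blockCount b 0 k                                  ≡⟨ cong (blockCount b 0) (ℕP.m+[n∸m]≡n e≤k) ⟨
    blockCount b 0 (e ℕ.+ (k ℕ.∸ e))                  ≡⟨ blockCount-+ b 0 e (k ℕ.∸ e) ⟩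
    blockCount b 0 e ℕ.+ blockCount b e (k ℕ.∸ e)     ≤⟨ ℕP.+-monoʳ-≤ (blockCount b 0 e) (blockCount≤length e (k ℕ.∸ e)) ⟩
    blockCount b 0 e ℕ.+ (k ℕ.∸ e)                    ∎
    where open ℕP.≤-Reasoning

  private
    shift : ∀ a k → blockCount b a (suc k) ≡ b (suc a) ℕ.+ blockCount b (suc a) k
    shift a k = trans (blockCount-+ b a 1 k) (cong (λ i → b i ℕ.+ blockCount b i k) (ℕP.+-comm a 1))

  blockCount-slide-≤ : ∀ k a → blockCount b (suc a) k ≤ suc (blockCount b a k)
  blockCount-slide-≤ k a = begin
    blockCount b (suc a) k                 ≤⟨ ℕP.m≤n+m _ (b (suc a)) ⟩
    b (suc a) ℕ.+ blockCount b (suc a) k   ≡⟨ shift a k ⟨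
    blockCount b a k ℕ.+ b (a ℕ.+ suc k)   ≤⟨ ℕP.+-monoʳ-≤ (blockCount b a k) (b≤1 (a ℕ.+ suc k)) ⟩
    blockCount b a k ℕ.+ 1                 ≡⟨ ℕP.+-comm _ 1 ⟩
    suc (blockCount b a k)                 ∎
    where open ℕP.≤-Reasoning

  blockCount-slide-≥ : ∀ k a → blockCount b a k ≤ suc (blockCount b (suc a) k)
  blockCount-slide-≥ k a = begin
    blockCount b a k                       ≤⟨ ℕP.m≤m+n _ (b (a ℕ.+ suc k)) ⟩
    blockCount b a (suc k)                 ≡⟨ shift a k ⟩
    b (suc a) ℕ.+ blockCount b (suc a) k   ≤⟨ ℕP.+-monoˡ-≤ (blockCount b (suc a) k) (b≤1 (suc a)) ⟩
    suc (blockCount b (suc a) k)           ∎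
    where open ℕP.≤-Reasoning

blockCount-blocks : ∀ b k v t a → (∀ j → j < t → v < blockCount b (a ℕ.+ j ℕ.* k) k) →
  t ℕ.* suc v ≤ blockCount b a (t ℕ.* k)
blockCount-blocks b k v zero    a _     = z≤n
blockCount-blocks b k v (suc t) a above = subst (suc v ℕ.+ t ℕ.* suc v ≤_) (sym (blockCount-+ b a k (t ℕ.* k)))
  (ℕP.+-mono-≤ (subst (λ i → v < blockCount b i k) (ℕP.+-identityʳ a) (above 0 (s≤s z≤n)))
               (blockCount-blocks b k v t (a ℕ.+ k) λ j j<t →
                  subst (λ i → v < blockCount b i k) (sym (ℕP.+-assoc a k (j ℕ.* k))) (above (suc j) (s≤s j<t))))

blockCount-heavy-blocks : ∀ b k v {n e t} → n ≡ e ℕ.+ t ℕ.* k → (∀ a → a ℕ.+ k ≤ n → v < blockCount b a k) →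
  blockCount b 0 e ℕ.+ t ℕ.* suc v ≤ blockCount b 0 n
blockCount-heavy-blocks b k v {n} {e} {t} n≡e+tk heavy = begin
  blockCount b 0 e ℕ.+ t ℕ.* suc v          ≤⟨ ℕP.+-monoʳ-≤ (blockCount b 0 e) (blockCount-blocks b k v t e later) ⟩
  blockCount b 0 e ℕ.+ blockCount b e (t ℕ.* k) ≡⟨ blockCount-+ b 0 e (t ℕ.* k) ⟨
  blockCount b 0 (e ℕ.+ t ℕ.* k)            ≡⟨ cong (blockCount b 0) n≡e+tk ⟨
  blockCount b 0 n                          ∎
  where
  open ℕP.≤-Reasoning
  later : ∀ j → j < t → v < blockCount b (e ℕ.+ j ℕ.* k) k
  later j j<t = heavy (e ℕ.+ j ℕ.* k) (begin
    e ℕ.+ j ℕ.* k ℕ.+ k     ≡⟨ ℕP.+-assoc e (j ℕ.* k) k ⟩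
    e ℕ.+ (j ℕ.* k ℕ.+ k)   ≡⟨ cong (e ℕ.+_) (ℕP.+-comm (j ℕ.* k) k) ⟩
    e ℕ.+ suc j ℕ.* k       ≤⟨ ℕP.+-monoʳ-≤ e (ℕP.*-monoˡ-≤ k j<t) ⟩
    e ℕ.+ t ℕ.* k           ≡⟨ n≡e+tk ⟨
    n                       ∎)

∀≤-suc : ∀ {P : ℕ → Set} {N} → (∀ a → a ≤ N → P a) → P (suc N) → ∀ a → a ≤ suc N → P a
∀≤-suc ∀≤N PsN a a≤sN with ℕP.m≤n⇒m<n∨m≡n a≤sN
... | inj₁ (s≤s a≤N) = ∀≤N a a≤N
... | inj₂ refl      = PsN

discrete-ivt : (h : ℕ → ℕ) (v : ℕ) → (∀ a → h (suc a) ≤ suc (h a)) → (∀ a → h a ≤ suc (h (suc a))) → ∀ N →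
  (Σ ℕ λ a → a ≤ N × h a ≡ v) ⊎ (∀ a → a ≤ N → h a < v) ⊎ (∀ a → a ≤ N → v < h a)
discrete-ivt h v up down zero with ℕP.<-cmp (h 0) v
... | tri< h0<v _ _ = inj₂ (inj₁ λ { .0 z≤n → h0<v })
... | tri≈ _ h0≡v _ = inj₁ (0 , z≤n , h0≡v)
... | tri> _ _ v<h0 = inj₂ (inj₂ λ { .0 z≤n → v<h0 })
discrete-ivt h v up down (suc N) with discrete-ivt h v up down N | ℕP.<-cmp (h (suc N)) v
... | inj₁ (a , a≤N , ha≡v) | _ = inj₁ (a , ℕP.m≤n⇒m≤1+n a≤N , ha≡v)
... | inj₂ _ | tri≈ _ hN≡v _ = inj₁ (suc N , ℕP.≤-refl , hN≡v)
... | inj₂ (inj₁ below) | tri< hN<v _ _ = inj₂ (inj₁ (∀≤-suc below hN<v))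
... | inj₂ (inj₁ below) | tri> _ _ v<hN = ⊥-elim (ℕP.<⇒≱ v<hN (ℕP.≤-trans (up N) (below N ℕP.≤-refl)))
... | inj₂ (inj₂ above) | tri< hN<v _ _ = ⊥-elim (ℕP.<⇒≱ (above N ℕP.≤-refl) (ℕP.≤-trans (down N) hN<v))
... | inj₂ (inj₂ above) | tri> _ _ v<hN = inj₂ (inj₂ (∀≤-suc above v<hN))

TwoValued : ℕ → ℕ → ℕ → (ℕ → ℤ) → Set
TwoValued r s n f = ∀ i → 1 ≤ i → i ≤ n → (f i ≡ - (+ r)) ⊎ (f i ≡ + s)

TwoValued-neg : ∀ {r s n f} → TwoValued r s n f → TwoValued s r n (λ i → - f i)
TwoValued-neg f∈ i 1≤i i≤n with f∈ i 1≤i i≤n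
... | inj₁ fi≡-r = inj₂ (trans (cong -_ fi≡-r) (ℤP.neg-involutive _))
... | inj₂ fi≡s  = inj₁ (cong -_ fi≡s)

hits : (ℕ → ℤ) → ℤ → ℕ → ℕ
hits f v i with f i ℤ.≟ v
... | yes _ = 1
... | no  _ = 0

hits≤1 : ∀ f v i → hits f v i ≤ 1
hits≤1 f v i with f i ℤ.≟ v
... | yes _ = ℕP.≤-refl
... | no  _ = z≤n

value-hits : ∀ r s f i → (f i ≡ - (+ r)) ⊎ (f i ≡ + s) → f i ℤ.+ + r ≡ + ((r ℕ.+ s) ℕ.* hits f (+ s) i)
value-hits r s f i fi∈ with f i ℤ.≟ + s | fi∈
... | yes fi≡s | _          = trans (cong (ℤ._+ + r) fi≡s) (cong +_ (trans (ℕP.+-comm s r) (sym (ℕP.*-identityʳ (r ℕ.+ s)))))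
... | no  _    | inj₁ fi≡-r = trans (cong (ℤ._+ + r) fi≡-r) (trans (ℤP.+-inverseˡ (+ r)) (cong +_ (sym (ℕP.*-zeroʳ (r ℕ.+ s)))))
... | no  fi≢s | inj₂ fi≡s  = ⊥-elim (fi≢s fi≡s)

blockSum-hits : ∀ r s n f → TwoValued r s n f → ∀ a k → a ℕ.+ k ≤ n →
  blockSum f a k ℤ.+ + (r ℕ.* k) ≡ + ((r ℕ.+ s) ℕ.* blockCount (hits f (+ s)) a k)
blockSum-hits r s n f f∈ a zero    _  = cong +_ (trans (ℕP.*-zeroʳ r) (sym (ℕP.*-zeroʳ (r ℕ.+ s))))
blockSum-hits r s n f f∈ a (suc k) fits = begin
  blockSum f a k ℤ.+ f j ℤ.+ + (r ℕ.* suc k)          ≡⟨ cong (λ x → blockSum f a k ℤ.+ f j ℤ.+ + x) (ℕP.*-suc r k) ⟩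
  blockSum f a k ℤ.+ f j ℤ.+ (+ r ℤ.+ + (r ℕ.* k))    ≡⟨ regroup (blockSum f a k) (f j) (+ r) (+ (r ℕ.* k)) ⟩
  (blockSum f a k ℤ.+ + (r ℕ.* k)) ℤ.+ (f j ℤ.+ + r)  ≡⟨ cong₂ ℤ._+_ (blockSum-hits r s n f f∈ a k fits′) (value-hits r s f j (f∈ j 1≤j fits)) ⟩
  + ((r ℕ.+ s) ℕ.* blockCount b a k ℕ.+ (r ℕ.+ s) ℕ.* b j)
                                                       ≡⟨ cong +_ (ℕP.*-distribˡ-+ (r ℕ.+ s) (blockCount b a k) (b j)) ⟨
  + ((r ℕ.+ s) ℕ.* blockCount b a (suc k))             ∎
  where
  open ≡-Reasoning
  j = a ℕ.+ suc k
  b = hits f (+ s)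
  fits′ : a ℕ.+ k ≤ n
  fits′ = ℕP.≤-trans (ℕP.+-monoʳ-≤ a (ℕP.n≤1+n k)) fits
  1≤j : 1 ≤ j
  1≤j = ℕP.≤-trans (s≤s z≤n) (ℕP.m≤n+m (suc k) a)
  regroup : ∀ x y z w → x ℤ.+ y ℤ.+ (z ℤ.+ w) ≡ (x ℤ.+ w) ℤ.+ (y ℤ.+ z)
  regroup = solve-∀

blockSum-neg : ∀ f a k → blockSum (λ i → - f i) a k ≡ - blockSum f a k
blockSum-neg f a zero    = refl
blockSum-neg f a (suc k) = trans (cong (ℤ._+ - f (a ℕ.+ suc k)) (blockSum-neg f a k))
                                 (sym (ℤP.neg-distrib-+ (blockSum f a k) (f (a ℕ.+ suc k))))

blockSum-balance : ∀ r s m n f → TwoValued r s n f → ∀ a → a ℕ.+ m ℕ.* (r ℕ.+ s) ≤ n →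
  blockSum f a (m ℕ.* (r ℕ.+ s)) ℤ.+ + ((r ℕ.+ s) ℕ.* (r ℕ.* m))
    ≡ + ((r ℕ.+ s) ℕ.* blockCount (hits f (+ s)) a (m ℕ.* (r ℕ.+ s)))
blockSum-balance r s m n f f∈ a fits =
  subst (λ x → blockSum f a (m ℕ.* (r ℕ.+ s)) ℤ.+ + x ≡ + ((r ℕ.+ s) ℕ.* blockCount (hits f (+ s)) a (m ℕ.* (r ℕ.+ s))))
        (rearrange r s m) (blockSum-hits r s n f f∈ a (m ℕ.* (r ℕ.+ s)) fits)
  where
  rearrange : ∀ r s m → r ℕ.* (m ℕ.* (r ℕ.+ s)) ≡ (r ℕ.+ s) ℕ.* (r ℕ.* m)
  rearrange = ℕ-Solver.solve-∀

i+k-k≡i : ∀ i k → i ℤ.+ k ℤ.- k ≡ i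
i+k-k≡i = solve-∀

+-cancelʳ-< : ∀ {i j} k → i ℤ.+ k ℤ.< j ℤ.+ k → i ℤ.< j
+-cancelʳ-< {i} {j} k lt = subst₂ ℤ._<_ (i+k-k≡i i k) (i+k-k≡i j k) (ℤP.+-monoˡ-< (- k) lt)

module _ {X : ℤ} {u v : ℕ} (offset : X ℤ.+ + u ≡ + v) where

  ≡0-by-offset : v ≡ u → X ≡ 0ℤ
  ≡0-by-offset refl = trans (sym (i+k-k≡i X (+ u))) (trans (cong (ℤ._- + u) offset) (ℤP.+-inverseʳ (+ u)))

  <0-by-offset : v < u → X ℤ.< 0ℤ
  <0-by-offset v<u = +-cancelʳ-< (+ u) (subst (ℤ._< + u) (sym offset) (ℤ.+<+ v<u))

  <-by-offset : ∀ {w} → w ℕ.+ u < v → + w ℤ.< X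
  <-by-offset {w} lt = +-cancelʳ-< (+ u) (subst (+ (w ℕ.+ u) ℤ.<_) (sym offset) (ℤ.+<+ lt))

  <-from-offset : ∀ {w} → + w ℤ.< X → w ℕ.+ u < v
  <-from-offset {w} lt = ℤP.drop‿+<+ (subst (+ (w ℕ.+ u) ℤ.<_) offset (ℤP.+-monoˡ-< (+ u) lt))

blockSum-trichotomy : ∀ r s k n f .{{_ : NonZero r}} → TwoValued r s n f → (r ℕ.+ s) ∣ k → k ≤ n →
  (Σ ℕ λ a → a ℕ.+ k ≤ n × blockSum f a k ≡ 0ℤ) ⊎
  (∀ a → a ℕ.+ k ≤ n → blockSum f a k ℤ.< 0ℤ) ⊎
  (∀ a → a ℕ.+ k ≤ n → 0ℤ ℤ.< blockSum f a k)
blockSum-trichotomy r@(suc _) s _ n f f∈ (divides m refl) k≤n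
  with discrete-ivt (λ a → blockCount (hits f (+ s)) a (m ℕ.* (r ℕ.+ s))) (r ℕ.* m)
         (blockCount-slide-≤ (hits f (+ s)) (hits≤1 f (+ s)) (m ℕ.* (r ℕ.+ s)))
         (blockCount-slide-≥ (hits f (+ s)) (hits≤1 f (+ s)) (m ℕ.* (r ℕ.+ s)))
         (n ℕ.∸ m ℕ.* (r ℕ.+ s))
... | inj₁ (a , a≤ , hit) = inj₁ (a , fits , ≡0-by-offset (blockSum-balance r s m n f f∈ a fits) (cong ((r ℕ.+ s) ℕ.*_) hit))
  where fits = ℕP.m≤o∸n⇒m+n≤o a k≤n a≤
... | inj₂ (inj₁ light) = inj₂ (inj₁ λ a fits →
  <0-by-offset (blockSum-balance r s m n f f∈ a fits) (ℕP.*-monoʳ-< (r ℕ.+ s) (light a (ℕP.m+n≤o⇒m≤o∸n a fits))))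
... | inj₂ (inj₂ heavy) = inj₂ (inj₂ λ a fits →
  <-by-offset (blockSum-balance r s m n f f∈ a fits) (ℕP.*-monoʳ-< (r ℕ.+ s) (heavy a (ℕP.m+n≤o⇒m≤o∸n a fits))))

total-exceeds : ∀ r s k q n .{{_ : NonZero r}} .{{_ : NonZero s}} (f : ℕ → ℤ) → TwoValued r s n f →
  (r ℕ.+ s) ∣ k → k ≤ n → bound₁ r s k q ℚ.≤ frac (+ n) 1 →
  (∀ a → a ℕ.+ k ≤ n → 0ℤ ℤ.< blockSum f a k) → + q ℤ.< total f n
total-exceeds r s _ q n f f∈ (divides zero refl) k≤n bound positive = ⊥-elim (ℤP.<-irrefl refl (positive 0 z≤n))
total-exceeds r@(suc _) s@(suc _) _ q n f f∈ (divides m@(suc _) refl) k≤n bound positive =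
  <-by-offset (blockSum-hits r s n f f∈ 0 n ℕP.≤-refl) (begin-strict
    q ℕ.+ r ℕ.* n                         ≡⟨ cong (λ x → q ℕ.+ r ℕ.* x) n≡e+tk ⟩
    q ℕ.+ r ℕ.* (e ℕ.+ t ℕ.* k)           ≡⟨ split q r e (t ℕ.* k) ⟩
    q ℕ.+ r ℕ.* e ℕ.+ r ℕ.* (t ℕ.* k)     <⟨ ℕP.+-monoˡ-< (r ℕ.* (t ℕ.* k)) remainder ⟩
    d ℕ.* (c ℕ.+ t) ℕ.+ r ℕ.* (t ℕ.* k)   ≡⟨ collect r s m c t ⟩
    d ℕ.* (c ℕ.+ t ℕ.* suc (r ℕ.* m))     ≤⟨ ℕP.*-monoʳ-≤ d heavy-blocks ⟩
    d ℕ.* blockCount b 0 n                ∎)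
  where
  open ℕP.≤-Reasoning
  split : ∀ q r e x → q ℕ.+ r ℕ.* (e ℕ.+ x) ≡ q ℕ.+ r ℕ.* e ℕ.+ r ℕ.* x
  split = ℕ-Solver.solve-∀
  collect : ∀ r s m c t → (r ℕ.+ s) ℕ.* (c ℕ.+ t) ℕ.+ r ℕ.* (t ℕ.* (m ℕ.* (r ℕ.+ s)))
                        ≡ (r ℕ.+ s) ℕ.* (c ℕ.+ t ℕ.* (1 ℕ.+ r ℕ.* m))
  collect = ℕ-Solver.solve-∀
  unfold-k : ∀ r s m c → c ℕ.+ m ℕ.* (r ℕ.+ s) ≡ r ℕ.* m ℕ.+ (c ℕ.+ s ℕ.* m)
  unfold-k = ℕ-Solver.solve-∀
  d = r ℕ.+ s
  k = m ℕ.* d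
  b = hits f (+ s)
  t = n / k
  e = n % k
  c = blockCount b 0 e
  n≡e+tk : n ≡ e ℕ.+ t ℕ.* k
  n≡e+tk = m≡m%n+[m/n]*n n k
  e<k : e < k
  e<k = m%n<n n k
  heavy : ∀ a → a ℕ.+ k ≤ n → r ℕ.* m < blockCount b a k
  heavy a fits = ℕP.*-cancelˡ-< d _ _ (<-from-offset (blockSum-balance r s m n f f∈ a fits) (positive a fits))
  heavy-blocks : c ℕ.+ t ℕ.* suc (r ℕ.* m) ≤ blockCount b 0 n
  heavy-blocks = blockCount-heavy-blocks b k (r ℕ.* m) {n} {e} {t} n≡e+tk heavy
  first-block : blockCount b 0 k ≤ c ℕ.+ (k ℕ.∸ e)
  first-block = blockCount≤prefix+rest b (hits≤1 f (+ s)) (ℕP.<⇒≤ e<k)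
  e-bound : e < c ℕ.+ s ℕ.* m
  e-bound = ℕP.+-cancelˡ-< (r ℕ.* m) e (c ℕ.+ s ℕ.* m) (begin-strict
    r ℕ.* m ℕ.+ e             <⟨ ℕP.+-monoˡ-< e (ℕP.<-≤-trans (heavy 0 k≤n) first-block) ⟩
    c ℕ.+ (k ℕ.∸ e) ℕ.+ e     ≡⟨ ℕP.+-assoc c (k ℕ.∸ e) e ⟩
    c ℕ.+ (k ℕ.∸ e ℕ.+ e)     ≡⟨ cong (c ℕ.+_) (ℕP.m∸n+n≡m (ℕP.<⇒≤ e<k)) ⟩
    c ℕ.+ k                   ≡⟨ unfold-k r s m c ⟩
    r ℕ.* m ℕ.+ (c ℕ.+ s ℕ.* m) ∎)
  remainder : q ℕ.+ r ℕ.* e < d ℕ.* (c ℕ.+ t)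
  remainder = remainder-bound r s m q t e c (boundFloor r s k q) e<k e-bound (q+rsm<s[boundFloor]*d+r r s m q)
    (subst (λ x → _ ℤ.≤ + x ℤ.* + s) n≡e+tk (bound₁-cleared r s m q n bound))

+<⇒<∣∣ : ∀ {q X} → + q ℤ.< X → q < ∣ X ∣
+<⇒<∣∣ {X = + _} q<X = ℤP.drop‿+<+ q<X

theorem2p9 : (r s k q n : ℕ) → 0 < r → 0 < s → 0 < k → (r ℕ.+ s) ∣ k →
  k ≤ n → bound₁ r s k q ℚ.≤ frac (+ n) 1 → bound₂ r s k q ℚ.≤ frac (+ n) 1 →
  (f : ℕ → ℤ) → (∀ i → 1 ≤ i → i ≤ n → (f i ≡ - (+ r)) ⊎ (f i ≡ + s)) →
  ∣ total f n ∣ ≤ q →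
  Σ ℕ (λ a → (a ℕ.+ k ≤ n) × (blockSum f a k ≡ + 0))
theorem2p9 r@(suc _) s@(suc _) k q n _ _ _ r+s∣k k≤n bound-r bound-s f f∈ ∣total∣≤q
  with blockSum-trichotomy r s k n f f∈ r+s∣k k≤n
... | inj₁ balanced-block = balanced-block
... | inj₂ (inj₂ positive) =
  ⊥-elim (ℕP.<⇒≱ (+<⇒<∣∣ (total-exceeds r s k q n f f∈ r+s∣k k≤n bound-r positive)) ∣total∣≤q)
... | inj₂ (inj₁ negative) = ⊥-elim (ℕP.<⇒≱ (subst (q <_) ∣-total∣≡∣total∣ (+<⇒<∣∣ exceeds)) ∣total∣≤q)
  where
  exceeds : + q ℤ.< total (λ i → - f i) n
  exceeds = total-exceeds s r k q n (λ i → - f i) (TwoValued-neg f∈) (subst (_∣ k) (ℕP.+-comm r s) r+s∣k) k≤n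
    (subst (ℚ._≤ frac (+ n) 1) (bound₂≡bound₁-swapped r s k q) bound-s)
    (λ a fits → subst (0ℤ ℤ.<_) (sym (blockSum-neg f a k)) (ℤP.neg-mono-< (negative a fits)))
  ∣-total∣≡∣total∣ : ∣ total (λ i → - f i) n ∣ ≡ ∣ total f n ∣
  ∣-total∣≡∣total∣ = trans (cong ∣_∣ (blockSum-neg f 0 n)) (ℤP.∣-i∣≡∣i∣ (total f n))
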